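{- Let $n\ge 3$ be an integer, $k$ a positive integer, $a=nk+1$, $S=\{a\}\cup[2a-n,2a-2]$ and $G=\langle S\rangle$. For $i\in[0,k-1]$ let $A_{i,k}=\{(2i+1)a\}\cup[(2i+2)a-(i+1)n,\,(2i+2)a-2]$ and $B_{i,k}=\{(2i+2)a\}\cup[(2i+3)a-(i+1)n,\,(2i+3)a-2]$, and let $H=\{0\}\cup\bigcup_{i=0}^{k-1}(A_{i,k}\cup B_{i,k})\cup[2ka,\infty[$. Then $H$ is a numerical semigroup, $G=H$, and $H$ is an $n$-permutation numerical semigroup.
   Context: For $u\le v$ in $\mathbb{N}$, $[u,v]=\{x\in\mathbb{N}: u\le x\le v\}$ and $[u,\infty[\,=\{x\in\mathbb{N}:x\ge u\}$. A numerical semigroup is a submonoid $G$ of $(\mathbb{N},+,0)$ with $\mathbb{N}\setminus G$ finite; $\langle S\rangle$ is the submonoid generated by $S$. Write the elements of $G$ as $0=g_0<g_1<g_2<\cdots$. For $n\ge 1$, $G$ is an $n$-permutation numerical semigroup if $G=\langle g_1,\dots,g_n\rangle$ and for every integer $m\ge 0$ the tuple $(g_{mn+1}\bmod n,\dots,g_{mn+n}\bmod n)$ contains exactly one representative of each residue class of $\mathbb{Z}/n\mathbb{Z}$. -}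

module Defs where

open import Data.Nat using (ℕ; zero; suc; _+_; _*_; _∸_; _≤_; _<_; NonZero)
open import Data.Nat.DivMod using (_%_)
open import Data.Fin using (Fin; toℕ)
open import Data.Product using (Σ; ∃; ∃-syntax; ∃!; _×_; _,_)
open import Data.Sum using (_⊎_)
open import Relation.Binary.PropositionalEquality using (_≡_)

Subset : Set₁
Subset = ℕ → Set

_≐_ : Subset → Subset → Set
P ≐ Q = ∀ x → (P x → Q x) × (Q x → P x)

_∈[_,_] : ℕ → ℕ → ℕ → Set
x ∈[ u , v ] = u ≤ x × x ≤ v

data ⟨_⟩ (S : Subset) : Subset where
  gen-zero : ⟨ S ⟩ 0
  gen-elem : ∀ {x} → S x → ⟨ S ⟩ x
  gen-add  : ∀ {x y} → ⟨ S ⟩ x → ⟨ S ⟩ y → ⟨ S ⟩ (x + y)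

record IsNumericalSemigroup (G : Subset) : Set where
  field
    has-zero  : G 0
    closed-+  : ∀ {x y} → G x → G y → G (x + y)
    cofinite  : ∃[ N ] (∀ x → N ≤ x → G x)

record Enumerates (G : Subset) (g : ℕ → ℕ) : Set where
  field
    strictly-increasing : ∀ i → g i < g (suc i)
    in-G                : ∀ i → G (g i)
    surjective          : ∀ x → G x → ∃[ i ] (g i ≡ x)

IsPermutationNS : (n : ℕ) → .{{NonZero n}} → Subset → Set
IsPermutationNS n G =
  IsNumericalSemigroup G ×
  Σ (ℕ → ℕ) λ g →
    Enumerates G g ×
    (G ≐ ⟨ (λ y → Σ (Fin n) λ j → g (suc (toℕ j)) ≡ y) ⟩) ×
    (∀ (m : ℕ) (r : Fin n) →
       ∃! _≡_ (λ (j : Fin n) → g (m * n + suc (toℕ j)) % n ≡ toℕ r))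

a : ℕ → ℕ → ℕ
a n k = n * k + 1

S : ℕ → ℕ → Subset
S n k x = x ≡ a n k ⊎ x ∈[ 2 * a n k ∸ n , 2 * a n k ∸ 2 ]

A : ℕ → ℕ → ℕ → Subset
A n k i x = x ≡ (2 * i + 1) * a n k
          ⊎ x ∈[ (2 * i + 2) * a n k ∸ (i + 1) * n , (2 * i + 2) * a n k ∸ 2 ]

B : ℕ → ℕ → ℕ → Subset
B n k i x = x ≡ (2 * i + 2) * a n k
          ⊎ x ∈[ (2 * i + 3) * a n k ∸ (i + 1) * n , (2 * i + 3) * a n k ∸ 2 ]

H : ℕ → ℕ → Subset
H n k x = x ≡ 0
        ⊎ (∃[ i ] (i < k × (A n k i x ⊎ B n k i x)))
        ⊎ 2 * k * a n k ≤ x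

{-# OPTIONS --safe #-}
-- Write α = nk + 1. The elements of H are exactly the numbers cα − δ with δ = 0 or
-- 2 ≤ δ ≤ ⌊c/2⌋n: for c ≤ 2k these levels are the heads and intervals of the blocks
-- A_i, B_i, and for larger c they fill [2kα, ∞[. This description is visibly closed
-- under addition and contains S, so ⟨S⟩ ⊆ H. Conversely, if d is least with δ ≤ dn,
-- then n ≥ 3 gives 2d ≤ δ, and cα − δ = (c − 2d)α + (2dα − δ) with 2dα − δ a sum of d
-- elements of [2α − n, 2α − 2]; hence H ⊆ ⟨S⟩.
-- Listing H as A₀, B₀, A₁, …, A_{k−1}, [2kα, ∞[, every block has a multiple of n
-- elements whose residues mod n are consecutive (α ≡ 1), so each run
-- g_{mn+1}, …, g_{mn+n} is a cyclic shift of all residues.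
module Submission where

open import Defs
open import Data.Bool using (Bool; true; false)
open import Data.Fin using (Fin; toℕ; fromℕ<)
open import Data.Fin.Properties using (toℕ<n; toℕ-fromℕ<; toℕ-injective)
open import Data.Nat
open import Data.Nat.DivMod
open import Data.Nat.Divisibility using (n∣m*n)
open import Data.Nat.Properties
open import Data.Nat.Tactic.RingSolver using (solve-∀)
open import Data.Product using (Σ; ∃-syntax; ∃!; _×_; _,_)
open import Data.Sum using (_⊎_; inj₁; inj₂)
open import Data.Unit using (⊤; tt)
open import Relation.Binary.PropositionalEquality
open import Relation.Nullary using (yes; no)
open import Relation.Nullary.Negation using (contradiction)
open import Function using (_∘_)

∈[∸]-from-+ : ∀ {x δ X Y} → x + δ ≡ X → δ ∈[ 2 , Y ] → x ∈[ X ∸ Y , X ∸ 2 ]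
∈[∸]-from-+ {x} {δ} refl (2≤δ , δ≤Y) =
  ≤-trans (∸-monoʳ-≤ (x + δ) δ≤Y) (≤-reflexive (m+n∸n≡m x δ)) ,
  subst (_≤ x + δ ∸ 2) (m+n∸n≡m x δ) (∸-monoʳ-≤ (x + δ) 2≤δ)

∈[∸]-to-+ : ∀ {x X Y} → 2 ≤ Y → Y ≤ X → x ∈[ X ∸ Y , X ∸ 2 ] →
            x + (X ∸ x) ≡ X × (X ∸ x) ∈[ 2 , Y ]
∈[∸]-to-+ {x} {X} {Y} 2≤Y Y≤X (lo , hi) =
  m+[n∸m]≡n (m+n≤o⇒m≤o x x+2≤X) ,
  m+n≤o⇒m≤o∸n 2 (subst (_≤ X) (+-comm x 2) x+2≤X) ,
  m≤n+o⇒m∸n≤o X x (subst (X ≤_) (+-comm Y x) (≤-trans (m≤n+m∸n X Y) (+-monoʳ-≤ Y lo)))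
  where
  x+2≤X : x + 2 ≤ X
  x+2≤X = m≤o∸n⇒m+n≤o x (≤-trans 2≤Y Y≤X) hi

0⊎≥2-+ : ∀ {u v} → u ≡ 0 ⊎ 2 ≤ u → v ≡ 0 ⊎ 2 ≤ v → u + v ≡ 0 ⊎ 2 ≤ u + v
0⊎≥2-+ (inj₁ refl) v≢1 = v≢1
0⊎≥2-+ {u} (inj₂ 2≤u) _ = inj₂ (≤-trans 2≤u (m≤m+n u _))

offset-gap : ∀ c {p Y} → suc p < Y → c + suc p + (Y ∸ p) ≡ c + suc Y × (Y ∸ p) ∈[ 2 , Y ]
offset-gap c {p} {Y} 1+p<Y =
  trans (regroup c p (Y ∸ p)) (cong (λ z → c + suc z) (m+[n∸m]≡n (≤-trans (n≤1+n p) (<⇒≤ 1+p<Y)))) ,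
  m+n≤o⇒m≤o∸n 2 1+p<Y , m∸n≤m Y p
  where
  regroup : ∀ c p w → c + suc p + w ≡ c + suc (p + w)
  regroup = solve-∀

offset-within : ∀ {x δ} c {Y} → x + δ ≡ c + suc Y → δ ∈[ 2 , Y ] → x ≡ c + suc (Y ∸ δ) × suc (Y ∸ δ) < Y
offset-within {x} {δ} c {Y} eq (2≤δ , δ≤Y) =
  +-cancelʳ-≡ δ x _ (trans eq (trans (cong (λ z → c + suc z) (sym (m∸n+n≡m δ≤Y))) (regroup c (Y ∸ δ) δ))) ,
  subst₂ _≤_ (+-comm (Y ∸ δ) 2) (m∸n+n≡m δ≤Y) (+-monoʳ-≤ (Y ∸ δ) 2≤δ)
  where
  regroup : ∀ c u v → c + suc (u + v) ≡ c + suc u + v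
  regroup = solve-∀

zero⊎odd⊎even : ∀ c → c ≡ 0 ⊎ (∃[ i ] c ≡ 2 * i + 1) ⊎ (∃[ i ] c ≡ 2 * i + 2)
zero⊎odd⊎even zero = inj₁ refl
zero⊎odd⊎even (suc zero) = inj₂ (inj₁ (0 , refl))
zero⊎odd⊎even (suc (suc c)) with zero⊎odd⊎even c
... | inj₁ refl = inj₂ (inj₂ (0 , refl))
... | inj₂ (inj₁ (i , refl)) = inj₂ (inj₁ (suc i , odd-step i))
  where
  odd-step : ∀ i → suc (suc (2 * i + 1)) ≡ 2 * suc i + 1
  odd-step = solve-∀
... | inj₂ (inj₂ (i , refl)) = inj₂ (inj₂ (suc i , even-step i))
  where
  even-step : ∀ i → suc (suc (2 * i + 2)) ≡ 2 * suc i + 2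
  even-step = solve-∀

half-≤ : ∀ {d i} → 2 * d ≤ 2 * i + 1 → d ≤ i
half-≤ {d} {i} le = <⇒≤pred (*-cancelˡ-< 2 d (suc i) (subst (2 * d <_) (2*i+2≡2*[1+i] i) (s≤s le)))
  where
  2*i+2≡2*[1+i] : ∀ i → suc (2 * i + 1) ≡ 2 * suc i
  2*i+2≡2*[1+i] = solve-∀

2[i+1]≤2i+3 : ∀ i → 2 * (i + 1) ≤ 2 * i + 3
2[i+1]≤2i+3 i = ≤-trans (≤-reflexive (*-distribˡ-+ 2 i 1)) (+-monoʳ-≤ (2 * i) (n≤1+n 2))

⟨⟩-mono : ∀ {P Q : Subset} → (∀ {x} → P x → Q x) → ∀ {x} → ⟨ P ⟩ x → ⟨ Q ⟩ x
⟨⟩-mono P⊆Q gen-zero      = gen-zero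
⟨⟩-mono P⊆Q (gen-elem p)  = gen-elem (P⊆Q p)
⟨⟩-mono P⊆Q (gen-add u v) = gen-add (⟨⟩-mono P⊆Q u) (⟨⟩-mono P⊆Q v)

⟨⟩-multiple : ∀ {P : Subset} {y} → P y → ∀ e → ⟨ P ⟩ (e * y)
⟨⟩-multiple py zero    = gen-zero
⟨⟩-multiple py (suc e) = gen-add (gen-elem py) (⟨⟩-multiple py e)

⟨⟩-interval-multiple : ∀ {P : Subset} {L U} → (∀ {y} → y ∈[ L , U ] → P y) → L ≤ U →
                       ∀ d {x} → x ∈[ d * L , d * U ] → ⟨ P ⟩ x
⟨⟩-interval-multiple P⊇ L≤U zero (_ , x≤0) = subst ⟨ _ ⟩ (sym (n≤0⇒n≡0 x≤0)) gen-zero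
⟨⟩-interval-multiple {P} {L} {U} P⊇ L≤U (suc d) {x} (lo , hi) with x ≤? L + d * U
... | yes x≤L+dU =
  subst ⟨ P ⟩ (m+[n∸m]≡n (m+n≤o⇒m≤o L lo))
    (gen-add (gen-elem (P⊇ (≤-refl , L≤U)))
             (⟨⟩-interval-multiple P⊇ L≤U d
               (m+n≤o⇒m≤o∸n (d * L) (subst (_≤ x) (+-comm L (d * L)) lo) , m≤n+o⇒m∸n≤o x L x≤L+dU)))
... | no x≰L+dU =
  subst ⟨ P ⟩ (m∸n+n≡m (m+n≤o⇒n≤o L L+dU≤x))
    (gen-add (gen-elem (P⊇ (m+n≤o⇒m≤o∸n L L+dU≤x ,
                            m≤n+o⇒m∸n≤o x (d * U) (subst (x ≤_) (+-comm U (d * U)) hi))))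
             (⟨⟩-interval-multiple P⊇ L≤U d (*-monoʳ-≤ d L≤U , ≤-refl)))
  where
  L+dU≤x : L + d * U ≤ x
  L+dU≤x = <⇒≤ (≰⇒> x≰L+dU)

2*[1+d]≤ : ∀ {n} → 3 ≤ n → ∀ d {δ} → 2 ≤ δ → d * n < δ → 2 * suc d ≤ δ
2*[1+d]≤ 3≤n zero    2≤δ _   = 2≤δ
2*[1+d]≤ {n} 3≤n (suc d) _ dn<δ =
  ≤-trans (subst (2 * suc (suc d) ≤_) (2*[2+d]+d≡1+[1+d]*3 d) (m≤m+n _ d))
          (≤-trans (s≤s (*-monoʳ-≤ (suc d) 3≤n)) dn<δ)
  where
  2*[2+d]+d≡1+[1+d]*3 : ∀ d → 2 * suc (suc d) + d ≡ suc (suc d * 3)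
  2*[2+d]+d≡1+[1+d]*3 = solve-∀

m/n*n+m%n≡m : ∀ m n .{{_ : NonZero n}} → m / n * n + m % n ≡ m
m/n*n+m%n≡m m n = trans (+-comm _ (m % n)) (sym (m≡m%n+[m/n]*n m n))

%-absorbˡ : ∀ m o n .{{_ : NonZero n}} → (m % n + o) % n ≡ (m + o) % n
%-absorbˡ m o n = begin
  (m % n + o) % n          ≡⟨ %-distribˡ-+ (m % n) o n ⟩
  (m % n % n + o % n) % n  ≡⟨ cong (λ z → (z + o % n) % n) (m%n%n≡m%n m n) ⟩
  (m % n + o % n) % n      ≡⟨ %-distribˡ-+ m o n ⟨
  (m + o) % n              ∎
  where open ≡-Reasoning

%-absorbʳ : ∀ m o n .{{_ : NonZero n}} → (m + o % n) % n ≡ (m + o) % n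
%-absorbʳ m o n = trans (cong (_% n) (+-comm m (o % n))) (trans (%-absorbˡ o m n) (cong (_% n) (+-comm o m)))

shifted-residue-unique : ∀ n .{{_ : NonZero n}} ρ (r : Fin n) →
                         ∃! _≡_ (λ (j : Fin n) → (ρ + toℕ j) % n ≡ toℕ r)
shifted-residue-unique n ρ r = fromℕ< j<n , solves , unique
  where
  open ≡-Reasoning
  c : ℕ
  c = n ∸ ρ % n
  cancel : ∀ x → (ρ + x + c) % n ≡ x % n
  cancel x = trans (cong (_% n) ρ+x+c≡) ([m+kn]%n≡m%n x (suc (ρ / n)) n)
    where
    regroup : ∀ r q x c → r + q + x + c ≡ x + q + (r + c)
    regroup = solve-∀
    ρ+x+c≡ : ρ + x + c ≡ x + suc (ρ / n) * n
    ρ+x+c≡ = begin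
      ρ + x + c                      ≡⟨ cong (λ z → z + x + c) (m≡m%n+[m/n]*n ρ n) ⟩
      ρ % n + ρ / n * n + x + c      ≡⟨ regroup (ρ % n) (ρ / n * n) x c ⟩
      x + ρ / n * n + (ρ % n + c)    ≡⟨ cong (x + ρ / n * n +_) (m+[n∸m]≡n (m%n≤n ρ n)) ⟩
      x + ρ / n * n + n              ≡⟨ +-assoc x _ n ⟩
      x + (ρ / n * n + n)            ≡⟨ cong (x +_) (+-comm _ n) ⟩
      x + suc (ρ / n) * n            ∎
  j<n : (toℕ r + c) % n < n
  j<n = m%n<n (toℕ r + c) n
  solves : (ρ + toℕ (fromℕ< j<n)) % n ≡ toℕ r
  solves = begin
    (ρ + toℕ (fromℕ< j<n)) % n  ≡⟨ cong (λ z → (ρ + z) % n) (toℕ-fromℕ< j<n) ⟩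
    (ρ + (toℕ r + c) % n) % n   ≡⟨ %-absorbʳ ρ (toℕ r + c) n ⟩
    (ρ + (toℕ r + c)) % n       ≡⟨ cong (_% n) (+-assoc ρ (toℕ r) c) ⟨
    (ρ + toℕ r + c) % n         ≡⟨ cancel (toℕ r) ⟩
    toℕ r % n                   ≡⟨ m<n⇒m%n≡m (toℕ<n r) ⟩
    toℕ r                       ∎
  unique : ∀ {i} → (ρ + toℕ i) % n ≡ toℕ r → fromℕ< j<n ≡ i
  unique {i} shifted = toℕ-injective (begin
    toℕ (fromℕ< j<n)           ≡⟨ toℕ-fromℕ< j<n ⟩
    (toℕ r + c) % n            ≡⟨ cong (λ z → (z + c) % n) shifted ⟨
    ((ρ + toℕ i) % n + c) % n  ≡⟨ %-absorbˡ (ρ + toℕ i) c n ⟩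
    (ρ + toℕ i + c) % n        ≡⟨ cancel (toℕ i) ⟩
    toℕ i % n                  ≡⟨ m<n⇒m%n≡m (toℕ<n i) ⟩
    toℕ i                      ∎)

module Construction (n₀ K : ℕ) where

  n k α : ℕ
  n = 3 + n₀
  k = suc K
  α = a n k

  0<α : 0 < α
  0<α = ≤-trans (s≤s z≤n) (m≤n+m 1 (n * k))

  instance
    α-nonZero : NonZero α
    α-nonZero = >-nonZero 0<α

  3≤n : 3 ≤ n
  3≤n = s≤s (s≤s (s≤s z≤n))

  2≤n : 2 ≤ n
  2≤n = ≤-trans (n≤1+n 2) 3≤n

  n≤α : n ≤ α
  n≤α = ≤-trans (m≤m*n n k) (m≤m+n (n * k) 1)

  n≤2α : n ≤ 2 * α
  n≤2α = ≤-trans n≤α (m≤m+n α (α + 0))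

  -- The level description of H: x = cα − δ with δ = 0 or 2 ≤ δ ≤ dn for some d ≤ c/2.
  record H′ (x : ℕ) : Set where
    constructor short
    field
      c d δ  : ℕ
      x+δ≡cα : x + δ ≡ c * α
      2d≤c   : 2 * d ≤ c
      δ≤dn   : δ ≤ d * n
      δ≢1    : δ ≡ 0 ⊎ 2 ≤ δ

  H′-multiple : ∀ c → H′ (c * α)
  H′-multiple c = short c 0 0 (+-identityʳ (c * α)) z≤n z≤n (inj₁ refl)

  H′-+ : ∀ {x y} → H′ x → H′ y → H′ (x + y)
  H′-+ {x} {y} (short c d δ eq 2d≤c δ≤dn δ≢1) (short c′ d′ δ′ eq′ 2d′≤c′ δ′≤d′n δ′≢1) =
    short (c + c′) (d + d′) (δ + δ′) sum
      (subst (_≤ c + c′) (sym (*-distribˡ-+ 2 d d′)) (+-mono-≤ 2d≤c 2d′≤c′))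
      (subst (δ + δ′ ≤_) (sym (*-distribʳ-+ n d d′)) (+-mono-≤ δ≤dn δ′≤d′n))
      (0⊎≥2-+ δ≢1 δ′≢1)
    where
    interchange : ∀ x y u v → x + y + (u + v) ≡ (x + u) + (y + v)
    interchange = solve-∀
    sum : x + y + (δ + δ′) ≡ (c + c′) * α
    sum = begin
      x + y + (δ + δ′)   ≡⟨ interchange x y δ δ′ ⟩
      (x + δ) + (y + δ′) ≡⟨ cong₂ _+_ eq eq′ ⟩
      c * α + c′ * α     ≡⟨ *-distribʳ-+ α c c′ ⟨
      (c + c′) * α       ∎
      where open ≡-Reasoning

  S⊆H′ : ∀ {y} → S n k y → H′ y
  S⊆H′ (inj₁ refl) = short 1 0 0 refl z≤n z≤n (inj₁ refl)
  S⊆H′ {y} (inj₂ y∈) with ∈[∸]-to-+ 2≤n n≤2α y∈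
  ... | eq , 2≤δ , δ≤n = short 2 1 (2 * α ∸ y) eq ≤-refl (≤-trans δ≤n (m≤m+n n 0)) (inj₂ 2≤δ)

  ⟨S⟩⊆H′ : ∀ {x} → ⟨ S n k ⟩ x → H′ x
  ⟨S⟩⊆H′ gen-zero      = H′-multiple 0
  ⟨S⟩⊆H′ (gen-elem s)  = S⊆H′ s
  ⟨S⟩⊆H′ (gen-add u v) = H′-+ (⟨S⟩⊆H′ u) (⟨S⟩⊆H′ v)

  short-by-sum : ∀ {x c d δ} → x + δ ≡ c * α → 2 * d ≤ c → 2 * d ≤ δ → δ ≤ d * n → ⟨ S n k ⟩ x
  short-by-sum {x} {c} {d} {δ} eq 2d≤c 2d≤δ δ≤dn =
    subst ⟨ S n k ⟩ (sym x≡eα+y)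
      (gen-add (⟨⟩-multiple (inj₁ refl) e) (⟨⟩-interval-multiple inj₂ (∸-monoʳ-≤ (2 * α) 2≤n) d (lo , hi)))
    where
    e : ℕ
    e = c ∸ 2 * d
    y : ℕ
    y = d * (2 * α) ∸ δ
    δ≤2dα : δ ≤ d * (2 * α)
    δ≤2dα = ≤-trans δ≤dn (*-monoʳ-≤ d n≤2α)
    split : ∀ d e α → (2 * d + e) * α ≡ e * α + d * (2 * α)
    split = solve-∀
    x≡eα+y : x ≡ e * α + y
    x≡eα+y = +-cancelʳ-≡ δ x (e * α + y) (begin
      x + δ                   ≡⟨ eq ⟩
      c * α                   ≡⟨ cong (_* α) (m+[n∸m]≡n 2d≤c) ⟨
      (2 * d + e) * α         ≡⟨ split d e α ⟩
      e * α + d * (2 * α)     ≡⟨ cong (e * α +_) (m∸n+n≡m δ≤2dα) ⟨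
      e * α + (y + δ)         ≡⟨ +-assoc (e * α) y δ ⟨
      e * α + y + δ           ∎)
      where open ≡-Reasoning
    lo : d * (2 * α ∸ n) ≤ y
    lo = subst (_≤ y) (sym (*-distribˡ-∸ d (2 * α) n)) (∸-monoʳ-≤ (d * (2 * α)) δ≤dn)
    hi : y ≤ d * (2 * α ∸ 2)
    hi = subst (y ≤_) (sym (*-distribˡ-∸ d (2 * α) 2))
           (∸-monoʳ-≤ (d * (2 * α)) (subst (_≤ δ) (*-comm 2 d) 2d≤δ))

  short-by : ∀ {x c δ} d → x + δ ≡ c * α → 2 * d ≤ c → 2 ≤ δ → δ ≤ d * n → ⟨ S n k ⟩ x
  short-by zero    _  _    2≤δ δ≤0 = contradiction (≤-trans 2≤δ δ≤0) λ ()
  short-by {δ = δ} (suc d) eq 2d≤c 2≤δ δ≤ with δ ≤? d * n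
  ... | yes δ≤dn = short-by d eq (≤-trans (*-monoʳ-≤ 2 (n≤1+n d)) 2d≤c) 2≤δ δ≤dn
  ... | no  δ≰dn = short-by-sum eq 2d≤c (2*[1+d]≤ 3≤n d 2≤δ (≰⇒> δ≰dn)) δ≤

  H′⊆⟨S⟩ : ∀ {x} → H′ x → ⟨ S n k ⟩ x
  H′⊆⟨S⟩ {x} (short c d δ eq _ _ (inj₁ refl)) =
    subst ⟨ S n k ⟩ (trans (sym eq) (+-identityʳ x)) (⟨⟩-multiple (inj₁ refl) c)
  H′⊆⟨S⟩ (short c d δ eq 2d≤c δ≤dn (inj₂ 2≤δ)) = short-by d eq 2d≤c 2≤δ δ≤dn

  dn≤cα : ∀ {c} d → 2 * d ≤ c → d * n ≤ c * α
  dn≤cα d 2d≤c = *-mono-≤ (≤-trans (m≤m+n d (d + 0)) 2d≤c) n≤α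

  H′-from-interval : ∀ {x} c d → 1 ≤ d → 2 * d ≤ c → x ∈[ c * α ∸ d * n , c * α ∸ 2 ] → H′ x
  H′-from-interval c d 1≤d 2d≤c x∈
    with ∈[∸]-to-+ (≤-trans 2≤n (m≤n*m n d {{>-nonZero 1≤d}})) (dn≤cα d 2d≤c) x∈
  ... | eq , 2≤δ , δ≤dn = short c d _ eq 2d≤c δ≤dn (inj₂ 2≤δ)

  H′-tail-inner : ∀ {r w} → suc (suc r) + suc w ≡ α → H′ (2 * k * α + suc r)
  H′-tail-inner {r} {w} α≡ =
    short (2 * k + 1) k (suc (suc w)) sum (m≤m+n (2 * k) 1) bound (inj₂ (s≤s (s≤s z≤n)))
    where
    regroup : ∀ x r w → x + suc r + suc (suc w) ≡ x + (suc (suc r) + suc w)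
    regroup = solve-∀
    collect : ∀ k a → 2 * k * a + a ≡ (2 * k + 1) * a
    collect = solve-∀
    sum : 2 * k * α + suc r + suc (suc w) ≡ (2 * k + 1) * α
    sum = begin
      2 * k * α + suc r + suc (suc w)    ≡⟨ regroup (2 * k * α) r w ⟩
      2 * k * α + (suc (suc r) + suc w)  ≡⟨ cong (2 * k * α +_) α≡ ⟩
      2 * k * α + α                      ≡⟨ collect k α ⟩
      (2 * k + 1) * α                    ∎
      where open ≡-Reasoning
    swap : ∀ r w → suc (suc r) + suc w ≡ suc (suc (suc w) + r)
    swap = solve-∀
    bound : suc (suc w) ≤ k * n
    bound = subst (suc (suc w) ≤_)
              (trans (suc-injective (trans (sym (swap r w)) (trans α≡ (+-comm (n * k) 1)))) (*-comm n k))
              (m≤m+n (suc (suc w)) r)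

  H′-tail-last : ∀ {r} → suc (suc r) + 0 ≡ α → H′ (2 * k * α + suc r)
  H′-tail-last {r} α≡ =
    short (2 * k + 2) (suc k) (suc α) sum (≤-reflexive (2*[1+k]≡ k)) bound (inj₂ (s≤s (s≤s z≤n)))
    where
    2*[1+k]≡ : ∀ k → 2 * suc k ≡ 2 * k + 2
    2*[1+k]≡ = solve-∀
    regroup : ∀ x r a → x + suc r + suc a ≡ x + (suc (suc r) + 0) + a
    regroup = solve-∀
    collect : ∀ k a → 2 * k * a + a + a ≡ (2 * k + 2) * a
    collect = solve-∀
    sum : 2 * k * α + suc r + suc α ≡ (2 * k + 2) * α
    sum = begin
      2 * k * α + suc r + suc α          ≡⟨ regroup (2 * k * α) r α ⟩
      2 * k * α + (suc (suc r) + 0) + α  ≡⟨ cong (λ z → 2 * k * α + z + α) α≡ ⟩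
      2 * k * α + α + α                  ≡⟨ collect k α ⟩
      (2 * k + 2) * α                    ∎
      where open ≡-Reasoning
    1+α≡ : ∀ N k → suc (N * k + 1) ≡ N * k + 2
    1+α≡ = solve-∀
    [1+k]*N≡ : ∀ N k → N * k + N ≡ suc k * N
    [1+k]*N≡ = solve-∀
    bound : suc α ≤ suc k * n
    bound = begin
      suc α      ≡⟨ 1+α≡ n k ⟩
      n * k + 2  ≤⟨ +-monoʳ-≤ (n * k) 2≤n ⟩
      n * k + n  ≡⟨ [1+k]*N≡ n k ⟩
      suc k * n  ∎
      where open ≤-Reasoning

  -- 2kα + r lies just below (2k + 1)α, or, for r = α − 1, just below (2k + 2)α.
  H′-tail-remainder : ∀ r → r < α → H′ (2 * k * α + r)
  H′-tail-remainder zero    _   = subst H′ (sym (+-identityʳ (2 * k * α))) (H′-multiple (2 * k))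
  H′-tail-remainder (suc r) r<α with α ∸ suc (suc r) | m+[n∸m]≡n r<α
  ... | zero  | α≡ = H′-tail-last α≡
  ... | suc _ | α≡ = H′-tail-inner α≡

  H′-tail : ∀ t → H′ (2 * k * α + t)
  H′-tail t = subst H′ (trans (+-assoc (2 * k * α) (t % α) _) (cong (2 * k * α +_) (sym (m≡m%n+[m/n]*n t α))))
                (H′-+ (H′-tail-remainder (t % α) (m%n<n t α)) (H′-multiple (t / α)))

  H⊆H′ : ∀ {x} → H n k x → H′ x
  H⊆H′ (inj₁ refl) = H′-multiple 0
  H⊆H′ (inj₂ (inj₁ (i , _ , inj₁ (inj₁ refl)))) = H′-multiple (2 * i + 1)
  H⊆H′ (inj₂ (inj₁ (i , _ , inj₁ (inj₂ x∈)))) =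
    H′-from-interval (2 * i + 2) (i + 1) (m≤n+m 1 i) (≤-reflexive (*-distribˡ-+ 2 i 1)) x∈
  H⊆H′ (inj₂ (inj₁ (i , _ , inj₂ (inj₁ refl)))) = H′-multiple (2 * i + 2)
  H⊆H′ (inj₂ (inj₁ (i , _ , inj₂ (inj₂ x∈)))) =
    H′-from-interval (2 * i + 3) (i + 1) (m≤n+m 1 i) (2[i+1]≤2i+3 i) x∈
  H⊆H′ {x} (inj₂ (inj₂ 2kα≤x)) = subst H′ (m+[n∸m]≡n 2kα≤x) (H′-tail (x ∸ 2 * k * α))

  beyond-level-2k : ∀ {x c d δ} → x + δ ≡ c * α → 2 * d ≤ c → δ ≤ d * n → 2 * k + 1 ≤ c → 2 * k * α ≤ x
  beyond-level-2k {x} {c} {d} {δ} eq 2d≤c δ≤dn 2k+1≤c = +-cancelʳ-≤ δ (2 * k * α) x (begin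
    2 * k * α + δ            ≤⟨ +-monoʳ-≤ (2 * k * α) (≤-trans δ≤dn (*-monoˡ-≤ n d≤k+e)) ⟩
    2 * k * α + (k + e) * n  ≤⟨ +-monoʳ-≤ (2 * k * α) [k+e]n≤[1+e]α ⟩
    2 * k * α + (1 + e) * α  ≡⟨ collect k e α ⟩
    (2 * k + 1 + e) * α      ≡⟨ cong (_* α) (m+[n∸m]≡n 2k+1≤c) ⟩
    c * α                    ≡⟨ eq ⟨
    x + δ                    ∎)
    where
    open ≤-Reasoning
    e : ℕ
    e = c ∸ (2 * k + 1)
    collect : ∀ k e a → 2 * k * a + (1 + e) * a ≡ (2 * k + 1 + e) * a
    collect = solve-∀
    widen : ∀ k e → 2 * k + 1 + e + e ≡ 2 * (k + e) + 1
    widen = solve-∀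
    d≤k+e : d ≤ k + e
    d≤k+e = half-≤ (begin
      2 * d              ≤⟨ 2d≤c ⟩
      c                  ≡⟨ m+[n∸m]≡n 2k+1≤c ⟨
      2 * k + 1 + e      ≤⟨ m≤m+n _ e ⟩
      2 * k + 1 + e + e  ≡⟨ widen k e ⟩
      2 * (k + e) + 1    ∎)
    [k+e]n≤[1+e]α : (k + e) * n ≤ (1 + e) * α
    [k+e]n≤[1+e]α = begin
      (k + e) * n    ≡⟨ *-distribʳ-+ n k e ⟩
      k * n + e * n  ≤⟨ +-mono-≤ (≤-trans (≤-reflexive (*-comm k n)) (m≤m+n (n * k) 1)) (*-monoʳ-≤ e n≤α) ⟩
      α + e * α      ∎

  -- Level 2i + 1 holds the head of A_i and the interval of B_{i−1};
  -- level 2i + 2 holds the interval of A_i and the head of B_i.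
  odd-level : ∀ {x d δ} i → i < k → x + δ ≡ (2 * i + 1) * α → 2 * d ≤ 2 * i + 1 → δ ≤ d * n →
              δ ≡ 0 ⊎ 2 ≤ δ → H n k x
  odd-level {x} i i<k eq _ _ (inj₁ refl) = inj₂ (inj₁ (i , i<k , inj₁ (inj₁ (trans (sym (+-identityʳ x)) eq))))
  odd-level {d = d} zero _ _ 2d≤1 δ≤dn (inj₂ 2≤δ) =
    contradiction (≤-trans 2≤δ (≤-trans δ≤dn (*-monoˡ-≤ n (half-≤ {d} {0} 2d≤1)))) λ ()
  odd-level {d = d} (suc i) 1+i<k eq 2d≤ δ≤dn (inj₂ 2≤δ) =
    inj₂ (inj₁ (i , <-trans (n<1+n i) 1+i<k ,
                 inj₂ (inj₂ (∈[∸]-from-+ (trans eq (cong (_* α) (odd≡ i))) (2≤δ , δ≤)))))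
    where
    odd≡ : ∀ i → 2 * suc i + 1 ≡ 2 * i + 3
    odd≡ = solve-∀
    δ≤ : _ ≤ (i + 1) * n
    δ≤ = ≤-trans δ≤dn (*-monoˡ-≤ n (≤-trans (half-≤ {d} 2d≤) (≤-reflexive (+-comm 1 i))))

  even-level : ∀ {x d δ} i → i < k → x + δ ≡ (2 * i + 2) * α → 2 * d ≤ 2 * i + 2 → δ ≤ d * n →
               δ ≡ 0 ⊎ 2 ≤ δ → H n k x
  even-level {x} i i<k eq _ _ (inj₁ refl) = inj₂ (inj₁ (i , i<k , inj₂ (inj₁ (trans (sym (+-identityʳ x)) eq))))
  even-level {d = d} i i<k eq 2d≤ δ≤dn (inj₂ 2≤δ) =
    inj₂ (inj₁ (i , i<k , inj₁ (inj₂ (∈[∸]-from-+ eq (2≤δ , ≤-trans δ≤dn (*-monoˡ-≤ n d≤i+1))))))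
    where
    d≤i+1 : d ≤ i + 1
    d≤i+1 = *-cancelˡ-≤ 2 (subst (2 * d ≤_) (sym (*-distribˡ-+ 2 i 1)) 2d≤)

  H′⊆H : ∀ {x} → H′ x → H n k x
  H′⊆H (short c d δ eq 2d≤c δ≤dn δ≢1) with zero⊎odd⊎even c
  H′⊆H {x} (short _ _ _ eq _ _ _) | inj₁ refl = inj₁ (m+n≡0⇒m≡0 x eq)
  H′⊆H (short _ d _ eq 2d≤c δ≤dn δ≢1) | inj₂ (inj₁ (i , refl)) with i <? k
  ... | yes i<k = odd-level {d = d} i i<k eq 2d≤c δ≤dn δ≢1
  ... | no  i≮k =
    inj₂ (inj₂ (beyond-level-2k {d = d} eq 2d≤c δ≤dn (+-monoˡ-≤ 1 (*-monoʳ-≤ 2 (≮⇒≥ i≮k)))))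
  H′⊆H (short _ d _ eq 2d≤c δ≤dn δ≢1) | inj₂ (inj₂ (i , refl)) with i <? k
  ... | yes i<k = even-level {d = d} i i<k eq 2d≤c δ≤dn δ≢1
  ... | no  i≮k =
    inj₂ (inj₂ (beyond-level-2k {d = d} eq 2d≤c δ≤dn (+-mono-≤ (*-monoʳ-≤ 2 (≮⇒≥ i≮k)) (n≤1+n 1))))

  ⟨S⟩≐H : ⟨ S n k ⟩ ≐ H n k
  ⟨S⟩≐H x = H′⊆H ∘ ⟨S⟩⊆H′ , H′⊆⟨S⟩ ∘ H⊆H′

  H-numerical : IsNumericalSemigroup (H n k)
  H-numerical = record
    { has-zero = inj₁ refl
    ; closed-+ = λ hx hy → H′⊆H (H′-+ (H⊆H′ hx) (H⊆H′ hy))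
    ; cofinite = 2 * k * α , λ _ → inj₂ ∘ inj₂
    }

  2≤[i+1]n : ∀ i → 2 ≤ (i + 1) * n
  2≤[i+1]n i = ≤-trans 2≤n (m≤n*m n (i + 1) {{>-nonZero (m≤n+m 1 i)}})

  [i+1]n<α : ∀ {i} → i < k → (i + 1) * n < α
  [i+1]n<α {i} i<k = begin-strict
    (i + 1) * n  ≤⟨ *-monoˡ-≤ n (subst (_≤ k) (+-comm 1 i) i<k) ⟩
    k * n        ≡⟨ *-comm k n ⟩
    n * k        <⟨ m<m+n (n * k) (s≤s z≤n) ⟩
    α            ∎
    where open ≤-Reasoning

  b : ℕ → ℕ
  b i = (i + 1) * (2 * n * K + n) + 2 * i + 1

  b-spec : ∀ i → b i + suc ((i + 1) * n) ≡ (2 * i + 2) * α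
  b-spec i = lemma n K i
    where
    lemma : ∀ n K i → (i + 1) * (2 * n * K + n) + 2 * i + 1 + suc ((i + 1) * n) ≡ (2 * i + 2) * (n * suc K + 1)
    lemma = solve-∀

  [2i+2]α≡α+[2i+1]α : ∀ i → (2 * i + 2) * α ≡ α + (2 * i + 1) * α
  [2i+2]α≡α+[2i+1]α i = lemma i α
    where
    lemma : ∀ i α → (2 * i + 2) * α ≡ α + (2 * i + 1) * α
    lemma = solve-∀

  -- A-elem i lists A_i increasingly, its interval part starting at b i + 1; B_i = α + A_i.
  A-elem : ℕ → ℕ → ℕ
  A-elem i zero    = (2 * i + 1) * α
  A-elem i (suc p) = b i + suc p

  A-elem∈A : ∀ i {p} → p < (i + 1) * n → A n k i (A-elem i p)
  A-elem∈A i {zero} _ = inj₁ refl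
  A-elem∈A i {suc p} 1+p<Y with offset-gap (b i) 1+p<Y
  ... | eq , δ∈ = inj₂ (∈[∸]-from-+ (trans eq (b-spec i)) δ∈)

  A-elem-onto : ∀ i {x} → A n k i x → ∃[ p ] p < (i + 1) * n × x ≡ A-elem i p
  A-elem-onto i (inj₁ refl) = 0 , ≤-trans (s≤s z≤n) (2≤[i+1]n i) , refl
  A-elem-onto i (inj₂ x∈) with ∈[∸]-to-+ (2≤[i+1]n i) (dn≤cα (i + 1) (≤-reflexive (*-distribˡ-+ 2 i 1))) x∈
  ... | eq , δ∈ with offset-within (b i) (trans eq (sym (b-spec i))) δ∈
  ... | x≡ , lt = _ , lt , x≡

  B-elem-onto : ∀ i {x} → B n k i x → ∃[ p ] p < (i + 1) * n × x ≡ α + A-elem i p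
  B-elem-onto i (inj₁ refl) = 0 , ≤-trans (s≤s z≤n) (2≤[i+1]n i) , [2i+2]α≡α+[2i+1]α i
  B-elem-onto i (inj₂ x∈) with ∈[∸]-to-+ (2≤[i+1]n i) (dn≤cα (i + 1) (2[i+1]≤2i+3 i)) x∈
  ... | eq , δ∈ with offset-within (α + b i) (trans eq (shift i)) δ∈
    where
    split : ∀ i α → (2 * i + 3) * α ≡ α + (2 * i + 2) * α
    split = solve-∀
    shift : ∀ i → (2 * i + 3) * α ≡ α + b i + suc ((i + 1) * n)
    shift i = trans (split i α) (trans (cong (α +_) (sym (b-spec i))) (sym (+-assoc α (b i) _)))
  ... | x≡ , lt = _ , lt , trans x≡ (+-assoc α (b i) _)

  block-elem : Bool → ℕ → ℕ → ℕ
  block-elem false i p = A-elem i p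
  block-elem true  i p = α + A-elem i p

  -- The enumeration runs through A₀, B₀, A₁, B₁, …, A_{k-1} and then the tail
  -- (B_{k-1} already lies in the tail); every block has a multiple of n elements
  -- and is cut into chunks of n consecutive elements.
  data Chunk : Set where
    block : (i : ℕ) (inB : Bool) (q : ℕ) → Chunk
    tail  : (q : ℕ) → Chunk

  value : Chunk → ℕ → ℕ
  value (block i inB q) r = block-elem inB i (q * n + r)
  value (tail q)        r = 2 * k * α + (q * n + r)

  after : ℕ → Bool → Chunk
  after i true = block (suc i) false 0
  after i false with suc i <? k
  ... | yes _ = block i true 0
  ... | no  _ = tail 0

  next : Chunk → Chunk
  next (block i inB q) with suc q ≤? i
  ... | yes _ = block i inB (suc q)
  ... | no  _ = after i inB
  next (tail q) = tail (suc q)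

  chunk : ℕ → Chunk
  chunk zero    = block 0 false 0
  chunk (suc m) = next (chunk m)

  g : ℕ → ℕ
  g zero    = 0
  g (suc t) = value (chunk (t / n)) (t % n)

  g-chunk : ∀ m r → r < n → g (suc (m * n + r)) ≡ value (chunk m) r
  g-chunk m r r<n = cong₂ (λ m′ r′ → value (chunk m′) r′) quotient remainder
    where
    quotient : (m * n + r) / n ≡ m
    quotient = begin
      (m * n + r) / n    ≡⟨ +-distrib-/-∣ˡ r (n∣m*n m) ⟩
      m * n / n + r / n  ≡⟨ cong₂ _+_ (m*n/n≡m m n) (m<n⇒m/n≡0 r<n) ⟩
      m + 0              ≡⟨ +-identityʳ m ⟩
      m                  ∎
      where open ≡-Reasoning
    remainder : (m * n + r) % n ≡ r
    remainder = trans (cong (_% n) (+-comm (m * n) r)) (trans ([m+kn]%n≡m%n r m n) (m<n⇒m%n≡m r<n))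

  by-chunk : ∀ {P : ℕ → Set} → (∀ m r → r < n → P (suc (m * n + r))) → ∀ t → P (suc t)
  by-chunk {P} f t = subst (P ∘ suc) (sym t≡) (f (t / n) (t % n) (m%n<n t n))
    where
    t≡ : t ≡ t / n * n + t % n
    t≡ = sym (m/n*n+m%n≡m t n)

  Valid : Chunk → Set
  Valid (block i inB q) = q ≤ i × i < k × (inB ≡ true → suc i < k)
  Valid (tail q)        = ⊤

  valid-after : ∀ {i} inB → i < k → (inB ≡ true → suc i < k) → Valid (after i inB)
  valid-after true  _ last = z≤n , last refl , λ ()
  valid-after {i} false i<k _ with suc i <? k
  ... | yes 1+i<k = z≤n , i<k , λ _ → 1+i<k
  ... | no  _     = tt

  valid-next : ∀ c → Valid c → Valid (next c)
  valid-next (block i inB q) (q≤i , i<k , last) with suc q ≤? i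
  ... | yes 1+q≤i = 1+q≤i , i<k , last
  ... | no  _     = valid-after inB i<k last
  valid-next (tail q) _ = tt

  valid-chunk : ∀ m → Valid (chunk m)
  valid-chunk zero    = z≤n , s≤s z≤n , λ ()
  valid-chunk (suc m) = valid-next (chunk m) (valid-chunk m)

  A-first≤b : ∀ {i} → i < k → (2 * i + 1) * α ≤ b i
  A-first≤b {i} i<k = +-cancelʳ-≤ (suc ((i + 1) * n)) _ _ (begin
    (2 * i + 1) * α + suc ((i + 1) * n)  ≤⟨ +-monoʳ-≤ ((2 * i + 1) * α) ([i+1]n<α i<k) ⟩
    (2 * i + 1) * α + α                  ≡⟨ +-comm _ α ⟩
    α + (2 * i + 1) * α                  ≡⟨ [2i+2]α≡α+[2i+1]α i ⟨
    (2 * i + 2) * α                      ≡⟨ b-spec i ⟨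
    b i + suc ((i + 1) * n)              ∎)
    where open ≤-Reasoning

  A-elem-< : ∀ {i p p′} → i < k → p < p′ → A-elem i p < A-elem i p′
  A-elem-< {i} {zero}  {suc p′} i<k _  = ≤-<-trans (A-first≤b i<k) (m<m+n (b i) (s≤s z≤n))
  A-elem-< {i} {suc p} {suc p′} _   lt = +-monoʳ-< (b i) lt

  A-elem<next-level : ∀ i {p} → p < (i + 1) * n → A-elem i p < (2 * i + 2) * α
  A-elem<next-level i {zero} _ =
    subst ((2 * i + 1) * α <_) (trans (+-comm _ α) (sym ([2i+2]α≡α+[2i+1]α i))) (m<m+n _ 0<α)
  A-elem<next-level i {suc p} lt = subst (b i + suc p <_) (b-spec i) (+-monoʳ-< (b i) (m<n⇒m<1+n lt))

  block-elem-< : ∀ inB {i p p′} → i < k → p < p′ → block-elem inB i p < block-elem inB i p′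
  block-elem-< false i<k lt = A-elem-< i<k lt
  block-elem-< true  i<k lt = +-monoʳ-< α (A-elem-< i<k lt)

  position< : ∀ {i q r} → q ≤ i → r < n → q * n + r < (i + 1) * n
  position< {i} {q} {r} q≤i r<n = begin-strict
    q * n + r  <⟨ +-monoʳ-< (q * n) r<n ⟩
    q * n + n  ≡⟨ +-comm (q * n) n ⟩
    suc q * n  ≤⟨ *-monoˡ-≤ n (subst (suc q ≤_) (+-comm 1 i) (s≤s q≤i)) ⟩
    (i + 1) * n ∎
    where open ≤-Reasoning

  last-position : ∀ q → suc (q * n + (n ∸ 1)) ≡ suc q * n + 0
  last-position q = lemma q n₀
    where
    lemma : ∀ q m → suc (q * suc (suc (suc m)) + suc (suc m)) ≡ suc q * suc (suc (suc m)) + 0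
    lemma = solve-∀

  value-suc : ∀ c r → Valid c → value c r < value c (suc r)
  value-suc (block i inB q) r (_ , i<k , _) = block-elem-< inB i<k (+-monoʳ-< (q * n) (n<1+n r))
  value-suc (tail q)        r _             = +-monoʳ-< (2 * k * α) (+-monoʳ-< (q * n) (n<1+n r))

  value-after : ∀ {i} inB {p} → i < k → (inB ≡ true → suc i < k) → p < (i + 1) * n →
                block-elem inB i p < value (after i inB) 0
  value-after {i} true {p} _ _ lt = subst (α + A-elem i p <_) (α+[2i+2]α≡ i α) (+-monoʳ-< α (A-elem<next-level i lt))
    where
    α+[2i+2]α≡ : ∀ i α → α + (2 * i + 2) * α ≡ (2 * suc i + 1) * α
    α+[2i+2]α≡ = solve-∀
  value-after {i} false {p} i<k _ lt with suc i <? k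
  ... | yes _ = subst (A-elem i p <_) ([2i+2]α≡α+[2i+1]α i) (A-elem<next-level i lt)
  ... | no 1+i≮k with ≤-antisym (≤-pred i<k) (≤-pred (≮⇒≥ 1+i≮k))
  ... | refl = subst (A-elem K p <_) ([2K+2]α≡ K α) (A-elem<next-level K lt)
    where
    [2K+2]α≡ : ∀ K α → (2 * K + 2) * α ≡ 2 * suc K * α + 0
    [2K+2]α≡ = solve-∀

  value-next : ∀ c → Valid c → value c (n ∸ 1) < value (next c) 0
  value-next (block i inB q) (q≤i , i<k , last) with suc q ≤? i
  ... | yes _ = block-elem-< inB i<k (≤-reflexive (last-position q))
  ... | no  _ = value-after inB i<k last (position< q≤i ≤-refl)
  value-next (tail q) _ = +-monoʳ-< (2 * k * α) (≤-reflexive (last-position q))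

  g-increasing : ∀ t → g t < g (suc t)
  g-increasing zero    = ≤-trans 0<α (m≤m+n α 0)
  g-increasing (suc t) = by-chunk {λ t → g t < g (suc t)} step t
    where
    step : ∀ m r → r < n → g (suc (m * n + r)) < g (suc (suc (m * n + r)))
    step m r r<n with suc r <? n
    ... | yes 1+r<n =
      subst₂ _<_ (sym (g-chunk m r r<n)) (sym (trans (cong (g ∘ suc) (sym (+-suc (m * n) r))) (g-chunk m (suc r) 1+r<n)))
        (value-suc (chunk m) r (valid-chunk m))
    ... | no 1+r≮n with ≤-antisym (≤-pred r<n) (≤-pred (≮⇒≥ 1+r≮n))
    ... | refl =
      subst₂ _<_ (sym (g-chunk m r r<n)) (sym (trans (cong g (cong suc (last-position m))) (g-chunk (suc m) 0 (s≤s z≤n))))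
        (value-next (chunk m) (valid-chunk m))

  H′-α : H′ α
  H′-α = S⊆H′ (inj₁ refl)

  value∈H′ : ∀ c r → Valid c → r < n → H′ (value c r)
  value∈H′ (block i false q) r (q≤i , i<k , _) r<n =
    H⊆H′ (inj₂ (inj₁ (i , i<k , inj₁ (A-elem∈A i (position< q≤i r<n)))))
  value∈H′ (block i true q) r (q≤i , i<k , _) r<n =
    H′-+ H′-α (H⊆H′ (inj₂ (inj₁ (i , i<k , inj₁ (A-elem∈A i (position< q≤i r<n))))))
  value∈H′ (tail q) r _ _ = H′-tail (q * n + r)

  g∈H : ∀ t → H n k (g t)
  g∈H zero    = inj₁ refl
  g∈H (suc t) = H′⊆H (value∈H′ (chunk (t / n)) (t % n) (valid-chunk (t / n)) (m%n<n t n))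

  Reachable : Chunk → Set
  Reachable c = ∃[ m ] chunk m ≡ c

  reachable-next : ∀ {c} → Reachable c → Reachable (next c)
  reachable-next (m , refl) = suc m , refl

  next-within : ∀ {i inB q} → suc q ≤ i → next (block i inB q) ≡ block i inB (suc q)
  next-within {i} {q = q} 1+q≤i with suc q ≤? i
  ... | yes _     = refl
  ... | no 1+q≰i = contradiction 1+q≤i 1+q≰i

  next-last : ∀ i inB → next (block i inB i) ≡ after i inB
  next-last i inB with suc i ≤? i
  ... | yes 1+i≤i = contradiction 1+i≤i (<-irrefl refl)
  ... | no  _     = refl

  after-A : ∀ {i} → suc i < k → after i false ≡ block i true 0
  after-A {i} 1+i<k with suc i <? k
  ... | yes _     = refl
  ... | no 1+i≮k = contradiction 1+i<k 1+i≮k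

  after-last-A : after K false ≡ tail 0
  after-last-A with suc K <? k
  ... | yes k<k = contradiction k<k (<-irrefl refl)
  ... | no  _   = refl

  reachable-within : ∀ {i inB} q → q ≤ i → Reachable (block i inB 0) → Reachable (block i inB q)
  reachable-within zero    _     R = R
  reachable-within (suc q) 1+q≤i R =
    subst Reachable (next-within 1+q≤i) (reachable-next (reachable-within q (<⇒≤ 1+q≤i) R))

  reachable-after : ∀ {i inB} → Reachable (block i inB 0) → Reachable (after i inB)
  reachable-after {i} {inB} R = subst Reachable (next-last i inB) (reachable-next (reachable-within i ≤-refl R))

  reachable-A : ∀ i → i < k → Reachable (block i false 0)
  reachable-B : ∀ i → suc i < k → Reachable (block i true 0)

  reachable-A zero    _     = 0 , refl
  reachable-A (suc i) 1+i<k = reachable-after (reachable-B i 1+i<k)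

  reachable-B i 1+i<k = subst Reachable (after-A 1+i<k) (reachable-after (reachable-A i (<-trans (n<1+n i) 1+i<k)))

  reachable-tail : ∀ q → Reachable (tail q)
  reachable-tail zero    = subst Reachable after-last-A (reachable-after (reachable-A K ≤-refl))
  reachable-tail (suc q) = reachable-next (reachable-tail q)

  reachable-value : ∀ {c} r → r < n → Reachable c → ∃[ t ] g t ≡ value c r
  reachable-value r r<n (m , refl) = suc (m * n + r) , g-chunk m r r<n

  reachable-block-elem : ∀ {i inB p} → Reachable (block i inB 0) → p < (i + 1) * n → ∃[ t ] g t ≡ block-elem inB i p
  reachable-block-elem {i} {inB} {p} R p<Y with reachable-value (p % n) (m%n<n p n) (reachable-within (p / n) q≤i R)
    where
    q≤i : p / n ≤ i
    q≤i = ≤-pred (subst (p / n <_) (+-comm i 1) (m<n*o⇒m/o<n p<Y))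
  ... | t , eq = t , trans eq (cong (block-elem inB i) (m/n*n+m%n≡m p n))

  tail-onto : ∀ {x} → 2 * k * α ≤ x → ∃[ t ] g t ≡ x
  tail-onto {x} 2kα≤x with reachable-value (d % n) (m%n<n d n) (reachable-tail (d / n))
    where
    d : ℕ
    d = x ∸ 2 * k * α
  ... | t , eq = t , trans eq (trans (cong (2 * k * α +_) (m/n*n+m%n≡m _ n)) (m+[n∸m]≡n 2kα≤x))

  B-last⊆tail : ∀ {x} → B n k K x → 2 * k * α ≤ x
  B-last⊆tail (inj₁ refl) = ≤-reflexive ([2K+2]α≡ K α)
    where
    [2K+2]α≡ : ∀ K α → 2 * suc K * α ≡ (2 * K + 2) * α
    [2K+2]α≡ = solve-∀
  B-last⊆tail {x} (inj₂ (lo , _)) = begin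
    2 * k * α                      ≡⟨ m+n∸n≡m (2 * k * α) α ⟨
    2 * k * α + α ∸ α              ≡⟨ cong (_∸ α) ([2K+3]α≡ K α) ⟩
    (2 * K + 3) * α ∸ α            ≤⟨ ∸-monoʳ-≤ ((2 * K + 3) * α) (<⇒≤ ([i+1]n<α ≤-refl)) ⟩
    (2 * K + 3) * α ∸ (K + 1) * n  ≤⟨ lo ⟩
    x                              ∎
    where
    open ≤-Reasoning
    [2K+3]α≡ : ∀ K α → 2 * suc K * α + α ≡ (2 * K + 3) * α
    [2K+3]α≡ = solve-∀

  B-onto : ∀ {i x} → i < k → B n k i x → ∃[ t ] g t ≡ x
  B-onto {i} i<k x∈B with suc i <? k
  ... | yes 1+i<k with B-elem-onto i x∈B
  ...   | p , p<Y , refl = reachable-block-elem (reachable-B i 1+i<k) p<Y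
  B-onto {i} i<k x∈B | no 1+i≮k with ≤-antisym (≤-pred i<k) (≤-pred (≮⇒≥ 1+i≮k))
  ...   | refl = tail-onto (B-last⊆tail x∈B)

  g-onto : ∀ {x} → H n k x → ∃[ t ] g t ≡ x
  g-onto (inj₁ refl) = 0 , refl
  g-onto (inj₂ (inj₁ (i , i<k , inj₁ x∈A))) with A-elem-onto i x∈A
  ... | p , p<Y , refl = reachable-block-elem (reachable-A i i<k) p<Y
  g-onto (inj₂ (inj₁ (i , i<k , inj₂ x∈B))) = B-onto i<k x∈B
  g-onto (inj₂ (inj₂ 2kα≤x)) = tail-onto 2kα≤x

  first-residue : Chunk → ℕ
  first-residue (block i false _) = 2 * i + 1
  first-residue (block i true  _) = 2 * i + 2
  first-residue (tail _)          = 2 * k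

  A-elem-residue : ∀ i p → ∃[ w ] A-elem i p ≡ 2 * i + 1 + p + w * n
  A-elem-residue i zero = (2 * i + 1) * k , lemma n K i
    where
    lemma : ∀ n K i → (2 * i + 1) * (n * suc K + 1) ≡ 2 * i + 1 + 0 + (2 * i + 1) * suc K * n
    lemma = solve-∀
  A-elem-residue i (suc p) = (i + 1) * (2 * K + 1) , lemma n K i p
    where
    lemma : ∀ n K i p → (i + 1) * (2 * n * K + n) + 2 * i + 1 + suc p ≡ 2 * i + 1 + suc p + (i + 1) * (2 * K + 1) * n
    lemma = solve-∀

  value-residue : ∀ c r → ∃[ w ] value c r ≡ first-residue c + r + w * n
  value-residue (block i false q) r =
    let (w , eq) = A-elem-residue i (q * n + r) in w + q , trans eq (lemma (2 * i + 1) q r w n)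
    where
    lemma : ∀ a q r w n → a + (q * n + r) + w * n ≡ a + r + (w + q) * n
    lemma = solve-∀
  value-residue (block i true q) r =
    let (w , eq) = A-elem-residue i (q * n + r) in w + q + k , trans (cong (α +_) eq) (lemma n K i q r w)
    where
    lemma : ∀ n K i q r w → n * suc K + 1 + (2 * i + 1 + (q * n + r) + w * n) ≡ 2 * i + 2 + r + (w + q + suc K) * n
    lemma = solve-∀
  value-residue (tail q) r = 2 * k * k + q , lemma n K q r
    where
    lemma : ∀ n K q r → 2 * suc K * (n * suc K + 1) + (q * n + r) ≡ 2 * suc K + r + (2 * suc K * suc K + q) * n
    lemma = solve-∀

  g-residue : ∀ m r → r < n → g (m * n + suc r) % n ≡ (first-residue (chunk m) + r) % n
  g-residue m r r<n =
    let (w , eq) = value-residue (chunk m) r in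
    trans (cong (λ t → g t % n) (+-suc (m * n) r))
          (trans (cong (_% n) (trans (g-chunk m r r<n) eq)) ([m+kn]%n≡m%n (first-residue (chunk m) + r) w n))

  permutation : ∀ m (r : Fin n) → ∃! _≡_ (λ (j : Fin n) → g (m * n + suc (toℕ j)) % n ≡ toℕ r)
  permutation m r with shifted-residue-unique n (first-residue (chunk m)) r
  ... | j , solves , unique =
    j , trans (g-residue m (toℕ j) (toℕ<n j)) solves ,
    λ {i} shifted → unique (trans (sym (g-residue m (toℕ i) (toℕ<n i))) shifted)

  A₀⊆S : ∀ {y} → A n k 0 y → S n k y
  A₀⊆S (inj₁ refl)      = inj₁ (+-identityʳ α)
  A₀⊆S {y} (inj₂ (lo , hi)) = inj₂ (subst (λ z → 2 * α ∸ z ≤ y) (+-identityʳ n) lo , hi)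

  S⊆A₀ : ∀ {y} → S n k y → A n k 0 y
  S⊆A₀ (inj₁ refl)      = inj₁ (sym (+-identityʳ α))
  S⊆A₀ {y} (inj₂ (lo , hi)) = inj₂ (subst (λ z → 2 * α ∸ z ≤ y) (sym (+-identityʳ n)) lo , hi)

  FirstChunk : Subset
  FirstChunk y = Σ (Fin n) λ j → g (suc (toℕ j)) ≡ y

  S⊆FirstChunk : ∀ {y} → S n k y → FirstChunk y
  S⊆FirstChunk s with A-elem-onto 0 (S⊆A₀ s)
  ... | p , p<n+0 , refl = fromℕ< p<n , trans (cong (g ∘ suc) (toℕ-fromℕ< p<n)) (g-chunk 0 p p<n)
    where
    p<n : p < n
    p<n = subst (p <_) (+-identityʳ n) p<n+0

  FirstChunk⊆S : ∀ {y} → FirstChunk y → S n k y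
  FirstChunk⊆S (j , refl) =
    A₀⊆S (subst (A n k 0) (sym (g-chunk 0 (toℕ j) (toℕ<n j)))
                (A-elem∈A 0 (subst (toℕ j <_) (sym (+-identityʳ n)) (toℕ<n j))))

  H≐⟨FirstChunk⟩ : H n k ≐ ⟨ FirstChunk ⟩
  H≐⟨FirstChunk⟩ x =
    ⟨⟩-mono S⊆FirstChunk ∘ H′⊆⟨S⟩ ∘ H⊆H′ , H′⊆H ∘ ⟨S⟩⊆H′ ∘ ⟨⟩-mono FirstChunk⊆S

  g-enumerates : Enumerates (H n k) g
  g-enumerates = record
    { strictly-increasing = g-increasing
    ; in-G                = g∈H
    ; surjective          = λ _ → g-onto
    }

lemma5p1 : (n k : ℕ) → .{{_ : NonZero n}} → 3 ≤ n → 1 ≤ k →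
    IsNumericalSemigroup (H n k) × (⟨ S n k ⟩ ≐ H n k) × IsPermutationNS n (H n k)
lemma5p1 (suc (suc (suc n₀))) (suc K) (s≤s (s≤s (s≤s z≤n))) (s≤s z≤n) =
  H-numerical , ⟨S⟩≐H , H-numerical , g , g-enumerates , H≐⟨FirstChunk⟩ , permutation
  where open Construction n₀ K
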